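{- For every (consistent) atomic base $\mathfrak{B}$ and every formula $A$ of $\mathscr{L}$, there is a closed argument $\langle \mathscr{D}, \mathfrak{J}\rangle$ with conclusion $A \vee \neg A$ which is valid on $\mathfrak{B}$.
   Context: The meta-language reasoning is classical. Language $\mathscr{L}$: formulas $X ::= p \mid \bot \mid X\wedge X \mid X \vee X \mid X \rightarrow X$ ($p$ propositional atoms; the $p$'s and $\bot$ are atoms); $\neg A := A\rightarrow\bot$. An atomic base $\mathfrak{B}$ is a countable set of production rules with atomic premises $A_1,\dots,A_n$ ($n\ge0$, $A_i\neq\bot$) and atomic conclusion; $\texttt{DER}_{\mathfrak{B}}$ is the set of its derivations, and bases are required to be consistent ($\bot$ is not derivable). An argument structure is a pair $\langle T,f\rangle$ where $T$ is a finite tree whose nodes are formulas of $\mathscr{L}$ or empty (empty nodes only as top-nodes), and $f$ is a function defined on a subset of the non-empty top-nodes assigning to each such node a node below it (discharge). Top-nodes are assumptions, the root is the conclusion; the structure is closed if all assumptions are discharged, else open; it is "from $\Gamma$ to $A$" if $\Gamma$ is its set of undischarged assumptions and $A$ its conclusion. For $\mathscr{D}$ from $\Gamma$ to $A$ and $\sigma$ assigning to each $B\in\Gamma$ a closed argument structure with conclusion $B$, $\mathscr{D}^\sigma$ is obtained by replacing each $B\in\Gamma$ by $\sigma(B)$. An inference is a triple $\langle\langle\mathscr{D}_1,\dots,\mathscr{D}_n\rangle, A,\delta\rangle$, $\delta$ indicating assumptions discharged; its associated argument structure joins the $\mathscr{D}_i$ under a new root $A$ with discharges extended by $\delta$. A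 rule is a set of inferences (its instances). The introduction rules are: from $A$ and $B$ infer $A\wedge B$; from $A_i$ infer $A_1\vee A_2$ ($i=1,2$); from $B$ infer $A\rightarrow B$ discharging $A$. An argument structure is canonical iff it is associated to an instance of an introduction rule. A justification of a rule $R$ is a constructive function $\phi$ defined on the argument structures associated to some subset of $R$ such that for each $\mathscr{D}$ in its domain: if $\mathscr{D}$ is from $\Gamma$ to $A$ then $\phi(\mathscr{D})$ is from some $\Gamma^*\subseteq\Gamma$ to $A$; and for every $\sigma$, $\phi$ is defined on $\mathscr{D}^\sigma$ and $\phi(\mathscr{D}^\sigma)=\phi(\mathscr{D})^\sigma$. For a set $\mathfrak{J}$ of justifications, $\mathscr{D}$ immediately reduces to $\mathscr{D}^*$ iff $\mathscr{D}=\mathscr{D}^*$ or, for some sub-structure $\mathscr{D}''$ of $\mathscr{D}$ and some $\phi\in\mathfrak{J}$ defined on $\mathscr{D}''$, $\mathscr{D}^*$ is $\mathscr{D}$ with $\mathscr{D}''$ replaced by $\phi(\mathscr{D}'')$; $\mathscr{D}\le^{\mathfrak{J}}\mathscr{D}^*$ iff there is a finite chain of immediate reductions from $\mathscr{D}$ to $\mathscr{D}^*$. An argument is a pair $\langle\mathscr{D},\mathfrak{J}\rangle$. It is valid on $\mathfrak{B}$ iff: (i) if $\mathscr{D}$ is closed with atomic conclusion, then $\mathscr{D}\le^{\mathfrak{J}}\langle T,\emptyset\rangle$ for some closed $T\in\texttt{DER}_{\mathfrak{B}}$; (ii) if $\mathscr{D}$ is closed with non-atomic conclusion, then $\mathscr{D}\le^{\mathfrak{J}}\mathscr{D}^*$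 for some closed canonical $\mathscr{D}^*$ whose immediate sub-structures, paired with $\mathfrak{J}$, are valid on $\mathfrak{B}$; (iii) if $\mathscr{D}$ is open from $\Gamma$ to $A$, then for every $\sigma$ and every set of justifications $\mathfrak{J}^+\supseteq\mathfrak{J}$, if $\langle\sigma(B),\mathfrak{J}^+\rangle$ is valid on $\mathfrak{B}$ for the $B\in\Gamma$, then $\langle\mathscr{D}^\sigma,\mathfrak{J}^+\rangle$ is valid on $\mathfrak{B}$. -}

module Defs where

open import Level using (Level; 0ℓ) renaming (suc to lsuc)
open import Data.Nat using (ℕ; zero; suc)
open import Data.Fin using (Fin; zero; suc)
open import Data.Maybe using (Maybe; just; nothing)
import Data.Maybe as Maybe
open import Data.List using (List; []; _∷_; _++_)
open import Data.List.Membership.Propositional using (_∈_)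
open import Data.Product using (Σ; _×_; _,_)
open import Data.Sum using (_⊎_)
open import Relation.Nullary using (¬_)
open import Relation.Binary.PropositionalEquality using (_≡_)
open import Relation.Binary.Construct.Closure.ReflexiveTransitive using (Star)

infixr 6 _∧'_
infixr 5 _∨'_
infixr 4 _⇒_

data Formula : Set where
  atom : ℕ → Formula
  ⊥'   : Formula
  _∧'_ : Formula → Formula → Formula
  _∨'_ : Formula → Formula → Formula
  _⇒_  : Formula → Formula → Formula

¬' : Formula → Formula
¬' A = A ⇒ ⊥'

data Atom : Set where
  prop : ℕ → Atom
  bot  : Atom

atomF : Atom → Formula
atomF (prop p) = atom p
atomF bot      = ⊥'

-- Argument structures.
-- 'Tree n' is a tree sitting below n ancestor nodes.  A top node is
-- either empty ('emp') or a formula ('hyp'); a formula top node may be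
-- discharged ('just i': by the ancestor i+1 levels below it) or not
-- ('nothing').

data Tree (n : ℕ) : Set where
  emp : Tree n
  hyp : Formula → Maybe (Fin n) → Tree n
  inf : Formula → Tree (suc n) → List (Tree (suc n)) → Tree n

ArgStr : Set
ArgStr = Tree 0

concl : ∀ {n} → Tree n → Maybe Formula
concl emp       = nothing
concl (hyp A _) = just A
concl (inf A _ _) = just A

-- assumption occurrences (top formula nodes) together with their
-- discharge status relative to the root of the given tree
down : ∀ {n} → List (Formula × Maybe (Fin (suc n))) → List (Formula × Maybe (Fin n))
down [] = []
down ((B , nothing) ∷ xs)      = (B , nothing) ∷ down xs
down ((B , just zero) ∷ xs)    = down xs
down ((B , just (suc i)) ∷ xs) = (B , just i) ∷ down xs

mutual
  occs : ∀ {n} → Tree n → List (Formula × Maybe (Fin n))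
  occs emp         = []
  occs (hyp B p)   = (B , p) ∷ []
  occs (inf A t ts) = down (occs t ++ occsL ts)

  occsL : ∀ {n} → List (Tree n) → List (Formula × Maybe (Fin n))
  occsL []       = []
  occsL (t ∷ ts) = occs t ++ occsL ts

Free : ∀ {n} → Tree n → Formula → Set
Free t B = (B , nothing) ∈ occs t

Closed : ∀ {n} → Tree n → Set
Closed t = ∀ B → ¬ Free t B

ext : ∀ {m k} → (Fin m → Maybe (Fin k)) → Fin (suc m) → Maybe (Fin (suc k))
ext f zero    = just zero
ext f (suc i) = Maybe.map suc (f i)

extG : ∀ {k} → (Formula → Maybe (Fin k)) → Formula → Maybe (Fin (suc k))
extG g B = Maybe.map suc (g B)

mutual
  rebind : ∀ {m k} → (Fin m → Maybe (Fin k)) → (Formula → Maybe (Fin k)) → Tree m → Tree k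
  rebind f g emp = emp
  rebind f g (hyp B nothing)  = hyp B (g B)
  rebind f g (hyp B (just i)) = hyp B (f i)
  rebind f g (inf A t ts) = inf A (rebind (ext f) (extG g) t) (rebindL (ext f) (extG g) ts)

  rebindL : ∀ {m k} → (Fin m → Maybe (Fin k)) → (Formula → Maybe (Fin k)) → List (Tree m) → List (Tree k)
  rebindL f g []       = []
  rebindL f g (t ∷ ts) = rebind f g t ∷ rebindL f g ts

-- a sub-structure taken on its own: discharges by nodes outside it are dropped
restrict : ∀ {n} → Tree n → ArgStr
restrict = rebind (λ _ → nothing) (λ _ → nothing)

reattach : ∀ {n} → (Formula → Maybe (Fin n)) → ArgStr → Tree n
reattach ρ = rebind (λ ()) ρ

weaken : ∀ {n} → ArgStr → Tree n
weaken = reattach (λ _ → nothing)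

mutual
  subst : ∀ {n} → (Formula → ArgStr) → Tree n → Tree n
  subst σ emp = emp
  subst σ (hyp B nothing)  = weaken (σ B)
  subst σ (hyp B (just i)) = hyp B (just i)
  subst σ (inf A t ts) = inf A (subst σ t) (substL σ ts)

  substL : ∀ {n} → (Formula → ArgStr) → List (Tree n) → List (Tree n)
  substL σ []       = []
  substL σ (t ∷ ts) = subst σ t ∷ substL σ ts

IsSubst : ArgStr → (Formula → ArgStr) → Set
IsSubst D σ = ∀ B → Free D B → Closed (σ B) × concl (σ B) ≡ just B

-- Inferences: premises 𝒟₁ … 𝒟ₙ (n ≥ 1), conclusion A; the premises are
-- given as 'Tree 1', a pointer 'zero' meaning "discharged by the new
-- root" (this encodes δ).

record Inference : Set where
  constructor mkInf
  field
    conclusion : Formula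
    prem₁      : Tree 1
    prems      : List (Tree 1)

assoc : Inference → ArgStr
assoc (mkInf A t ts) = inf A t ts

substInf : (Formula → ArgStr) → Inference → Inference
substInf σ (mkInf A t ts) = mkInf A (subst σ t) (substL σ ts)

Rule : Set₁
Rule = Inference → Set

record Justification : Set₁ where
  field
    rule     : Rule
    dom      : Inference → Set
    dom⊆rule : ∀ i → dom i → rule i
    φ        : (i : Inference) → dom i → ArgStr
    φ-concl  : ∀ i (d : dom i) → concl (φ i d) ≡ just (Inference.conclusion i)
    φ-free   : ∀ i (d : dom i) B → Free (φ i d) B → Free (assoc i) B
    φ-dom-σ  : ∀ i (d : dom i) σ → IsSubst (assoc i) σ → dom (substInf σ i)
    φ-σ      : ∀ i (d : dom i) σ (s : IsSubst (assoc i) σ) →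
               φ (substInf σ i) (φ-dom-σ i d σ s) ≡ subst σ (φ i d)

JSet : Set₁
JSet = Justification → Set

_⊆J_ : JSet → JSet → Set₁
J ⊆J J⁺ = ∀ φ → J φ → J⁺ φ

data OneOf {A : Set} (R : A → A → Set₁) : List A → List A → Set₁ where
  here  : ∀ {x y xs} → R x y → OneOf R (x ∷ xs) (y ∷ xs)
  there : ∀ {x xs ys} → OneOf R xs ys → OneOf R (x ∷ xs) (x ∷ ys)

data Step (J : JSet) : ∀ {n} → Tree n → Tree n → Set₁ where
  at : ∀ {n} {t : Tree n} (j : Justification) → J j →
       (i : Inference) (d : Justification.dom j i) → restrict t ≡ assoc i →
       (ρ : Formula → Maybe (Fin n)) →
       (∀ B → Free (Justification.φ j i d) B → (B , ρ B) ∈ occs t) →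
       Step J t (reattach ρ (Justification.φ j i d))
  below : ∀ {n} {A} {t t' : Tree (suc n)} {ts ts'} →
          OneOf (Step J) (t ∷ ts) (t' ∷ ts') →
          Step J (inf A t ts) (inf A t' ts')

ImmRed : JSet → ArgStr → ArgStr → Set₁
ImmRed J D D* = D ≡ D* ⊎ Step J D D*

_≤[_]_ : ArgStr → JSet → ArgStr → Set₁
D ≤[ J ] D* = Star (ImmRed J) D D*

record BRule : Set where
  constructor mkRule
  field
    premises : List ℕ      -- atomic premises, different from ⊥
    conc     : Atom

Base : Set₁
Base = BRule → Set

-- T ∈ DER_𝔅 (with empty discharge function); a zero-premise rule
-- application has an empty top node above its conclusion
mutual
  data IsDer (𝔅 : Base) {n : ℕ} : Tree n → Set where
    der-hyp   : (a : Atom) → IsDer 𝔅 (hyp (atomF a) nothing)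
    der-ax    : (a : Atom) → 𝔅 (mkRule [] a) → IsDer 𝔅 (inf (atomF a) emp [])
    der-rule  : (p : ℕ) (ps : List ℕ) (a : Atom) → 𝔅 (mkRule (p ∷ ps) a) →
                {t : Tree (suc n)} {ts : List (Tree (suc n))} →
                IsDer 𝔅 t → concl t ≡ just (atom p) → IsDerL 𝔅 ts ps →
                IsDer 𝔅 (inf (atomF a) t ts)

  data IsDerL (𝔅 : Base) {n : ℕ} : List (Tree n) → List ℕ → Set where
    []  : IsDerL 𝔅 [] []
    _∷_ : ∀ {t ts p ps} → IsDer 𝔅 t × concl t ≡ just (atom p) → IsDerL 𝔅 ts ps →
          IsDerL 𝔅 (t ∷ ts) (p ∷ ps)

Consistent : Base → Set
Consistent 𝔅 = ¬ (Σ ArgStr λ T → IsDer 𝔅 T × Closed T × concl T ≡ just ⊥')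

NoRootDis : Tree 1 → Set
NoRootDis t = ∀ B → ¬ ((B , just zero) ∈ occs t)

RootDisOnly : Formula → Tree 1 → Set
RootDisOnly A t = ∀ B → (B , just zero) ∈ occs t → B ≡ A

-- validity of closed arguments (clauses (i), (ii)); the clause for →
-- contains clause (iii) for the immediate sub-structure, whose
-- undischarged assumptions are among {A}
ValidC : Base → Formula → ArgStr → JSet → Set₁
ValidC 𝔅 (atom p) D J =
  Σ ArgStr λ T → IsDer 𝔅 T × Closed T × D ≤[ J ] T
ValidC 𝔅 ⊥' D J =
  Σ ArgStr λ T → IsDer 𝔅 T × Closed T × D ≤[ J ] T
ValidC 𝔅 (A ∧' B) D J =
  Σ (Tree 1) λ t → Σ (Tree 1) λ u →
    D ≤[ J ] inf (A ∧' B) t (u ∷ []) × Closed (inf (A ∧' B) t (u ∷ [])) ×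
    concl t ≡ just A × concl u ≡ just B × NoRootDis t × NoRootDis u ×
    ValidC 𝔅 A (restrict t) J × ValidC 𝔅 B (restrict u) J
ValidC 𝔅 (A ∨' B) D J =
  Σ (Tree 1) λ t →
    D ≤[ J ] inf (A ∨' B) t [] × Closed (inf (A ∨' B) t []) × NoRootDis t ×
    ((concl t ≡ just A × ValidC 𝔅 A (restrict t) J) ⊎
     (concl t ≡ just B × ValidC 𝔅 B (restrict t) J))
ValidC 𝔅 (A ⇒ B) D J =
  Σ (Tree 1) λ t →
    D ≤[ J ] inf (A ⇒ B) t [] × Closed (inf (A ⇒ B) t []) ×
    concl t ≡ just B × RootDisOnly A t ×
    (Closed (restrict t) → ValidC 𝔅 B (restrict t) J) ×
    (¬ Closed (restrict t) →
       ∀ (c : ArgStr) (J⁺ : JSet) → J ⊆J J⁺ → Closed c → concl c ≡ just A →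
       ValidC 𝔅 A c J⁺ → ValidC 𝔅 B (subst (λ _ → c) (restrict t)) J⁺)

Valid : Base → ArgStr → JSet → Set₁
Valid 𝔅 D J =
  (Closed D → ∀ A → concl D ≡ just A → ValidC 𝔅 A D J) ×
  (¬ Closed D → ∀ A → concl D ≡ just A →
     ∀ (σ : Formula → ArgStr) (J⁺ : JSet) → J ⊆J J⁺ →
     (∀ B → Free D B → Closed (σ B) × concl (σ B) ≡ just B × ValidC 𝔅 B (σ B) J⁺) →
     ValidC 𝔅 A (subst σ D) J⁺)

{-# OPTIONS --safe #-}
module Submission where

-- Reason classically on whether A has a closed argument valid on 𝔅.  If it
-- has one, ∨-introduction applied to it is valid.  If it has (const nothing), take the
-- unjustified inference from A to ⊥ and discharge A by →-introduction: the
-- result is a valid argument for ¬ A, vacuously, since clause (iii) only asks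
-- something of closed valid arguments for A.

open import Defs
open import Level using (0ℓ) renaming (suc to lsuc)
open import Axiom.ExcludedMiddle using (ExcludedMiddle)
open import Data.Empty using (⊥; ⊥-elim)
open import Function using (const)
open import Data.Nat as ℕ using (ℕ)
open import Data.Fin using (Fin; zero; suc)
open import Data.List using (List; []; _∷_; _++_; map)
open import Data.List.Properties using (map-++; ++-identityʳ)
open import Data.List.Membership.Propositional using (_∈_)
open import Data.List.Membership.Propositional.Properties using (∈-map⁻)
open import Data.List.Relation.Unary.Any using (here; there)
open import Data.Maybe using (Maybe; just; nothing)
import Data.Maybe as Maybe
open import Data.Maybe.Properties using (just-injective)
open import Data.Product using (Σ; _×_; _,_)
import Data.Sum as Sum
open import Data.Sum using (_⊎_; inj₁; inj₂)
open import Relation.Binary.Construct.Closure.ReflexiveTransitive using (ε)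
open import Relation.Binary.PropositionalEquality
  using (_≡_; refl; cong; cong₂; sym; trans; module ≡-Reasoning)
import Relation.Binary.PropositionalEquality as Eq
open import Relation.Nullary using (¬_; yes; no)

private
  variable
    m k n : ℕ

relabel : (Fin m → Maybe (Fin k)) → (Formula → Maybe (Fin k)) →
          Formula × Maybe (Fin m) → Formula × Maybe (Fin k)
relabel f g (B , nothing) = B , g B
relabel f g (B , just i)  = B , f i

down-relabel : (f : Fin m → Maybe (Fin k)) (g : Formula → Maybe (Fin k))
               (xs : List (Formula × Maybe (Fin (ℕ.suc m)))) →
               down (map (relabel (ext f) (extG g)) xs) ≡ map (relabel f g) (down xs)
down-relabel f g [] = refl
down-relabel f g ((B , nothing) ∷ xs) with g B
... | nothing = cong ((B , nothing) ∷_) (down-relabel f g xs)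
... | just i  = cong ((B , just i) ∷_) (down-relabel f g xs)
down-relabel f g ((B , just zero) ∷ xs) = down-relabel f g xs
down-relabel f g ((B , just (suc i)) ∷ xs) with f i
... | nothing = cong ((B , nothing) ∷_) (down-relabel f g xs)
... | just j  = cong ((B , just j) ∷_) (down-relabel f g xs)

mutual
  occs-rebind : (f : Fin m → Maybe (Fin k)) (g : Formula → Maybe (Fin k)) (t : Tree m) →
                occs (rebind f g t) ≡ map (relabel f g) (occs t)
  occs-rebind f g emp              = refl
  occs-rebind f g (hyp B nothing)  = refl
  occs-rebind f g (hyp B (just i)) = refl
  occs-rebind f g (inf A t ts) = begin
    down (occs (rebind f′ g′ t) ++ occsL (rebindL f′ g′ ts))
      ≡⟨ cong down (cong₂ _++_ (occs-rebind f′ g′ t) (occsL-rebind f′ g′ ts)) ⟩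
    down (map (relabel f′ g′) (occs t) ++ map (relabel f′ g′) (occsL ts))
      ≡⟨ cong down (sym (map-++ (relabel f′ g′) (occs t) (occsL ts))) ⟩
    down (map (relabel f′ g′) (occs t ++ occsL ts))
      ≡⟨ down-relabel f g (occs t ++ occsL ts) ⟩
    map (relabel f g) (down (occs t ++ occsL ts)) ∎
    where
    open ≡-Reasoning
    f′ = ext f
    g′ = extG g

  occsL-rebind : (f : Fin m → Maybe (Fin k)) (g : Formula → Maybe (Fin k)) (ts : List (Tree m)) →
                 occsL (rebindL f g ts) ≡ map (relabel f g) (occsL ts)
  occsL-rebind f g [] = refl
  occsL-rebind f g (t ∷ ts) = trans
    (cong₂ _++_ (occs-rebind f g t) (occsL-rebind f g ts))
    (sym (map-++ (relabel f g) (occs t) (occsL ts)))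

concl-rebind : (f : Fin m → Maybe (Fin k)) (g : Formula → Maybe (Fin k)) (t : Tree m) →
               concl (rebind f g t) ≡ concl t
concl-rebind f g emp              = refl
concl-rebind f g (hyp B nothing)  = refl
concl-rebind f g (hyp B (just i)) = refl
concl-rebind f g (inf A t ts)     = refl

LeftInverse : (Fin k → Maybe (Fin m)) → (Fin m → Maybe (Fin k)) → Set
LeftInverse f f′ = ∀ i → Σ _ λ j → f′ i ≡ just j × f j ≡ just i

ext-leftInverse : (f′ : Fin m → Maybe (Fin k)) (f : Fin k → Maybe (Fin m)) →
                  LeftInverse f f′ → LeftInverse (ext f) (ext f′)
ext-leftInverse f′ f inverse zero = zero , refl , refl
ext-leftInverse f′ f inverse (suc i) with inverse i
... | j , f′i≡j , fj≡i = suc j , cong (Maybe.map suc) f′i≡j , cong (Maybe.map suc) fj≡i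

mutual
  rebind-cancel : (f′ : Fin m → Maybe (Fin k)) (f : Fin k → Maybe (Fin m)) →
                  LeftInverse f f′ → (t : Tree m) →
                  rebind f (const nothing) (rebind f′ (const nothing) t) ≡ t
  rebind-cancel f′ f inverse emp              = refl
  rebind-cancel f′ f inverse (hyp B nothing)  = refl
  rebind-cancel f′ f inverse (hyp B (just i)) with inverse i
  ... | j , f′i≡j , fj≡i rewrite f′i≡j | fj≡i = refl
  rebind-cancel f′ f inverse (inf A t ts) =
    cong₂ (inf A) (rebind-cancel (ext f′) (ext f) (ext-leftInverse f′ f inverse) t)
                  (rebindL-cancel (ext f′) (ext f) (ext-leftInverse f′ f inverse) ts)

  rebindL-cancel : (f′ : Fin m → Maybe (Fin k)) (f : Fin k → Maybe (Fin m)) →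
                   LeftInverse f f′ → (ts : List (Tree m)) →
                   rebindL f (const nothing) (rebindL f′ (const nothing) ts) ≡ ts
  rebindL-cancel f′ f inverse [] = refl
  rebindL-cancel f′ f inverse (t ∷ ts) =
    cong₂ _∷_ (rebind-cancel f′ f inverse t) (rebindL-cancel f′ f inverse ts)

restrict-weaken : (c : ArgStr) → restrict (weaken {n} c) ≡ c
restrict-weaken = rebind-cancel (λ ()) (const nothing) (λ ())

concl-weaken : (c : ArgStr) → concl (weaken {n} c) ≡ concl c
concl-weaken = concl-rebind (λ ()) (const nothing)

∈-occs-weaken : ∀ (c : ArgStr) {B p} → (B , p) ∈ occs (weaken {n} c) → p ≡ nothing × Free c B
∈-occs-weaken c {B} {p} B∈
  with ∈-map⁻ (relabel (λ ()) (const nothing))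
              (Eq.subst ((B , p) ∈_) (occs-rebind (λ ()) (const nothing) c) B∈)
... | (B , nothing) , B∈c , refl = refl , B∈c

weaken-closed : (c : ArgStr) → Closed c → Closed (weaken {n} c)
weaken-closed c closed B B∈ with ∈-occs-weaken c B∈
... | _ , B∈c = closed B B∈c

weaken-noRootDis : (c : ArgStr) → NoRootDis (weaken c)
weaken-noRootDis c B B∈ with ∈-occs-weaken c B∈
... | () , _

free-down : ∀ {B} (xs : List (Formula × Maybe (Fin (ℕ.suc n)))) →
            (B , nothing) ∈ down xs → (B , nothing) ∈ xs
free-down ((C , nothing) ∷ xs)      (here refl) = here refl
free-down ((C , nothing) ∷ xs)      (there B∈)  = there (free-down xs B∈)
free-down ((C , just zero) ∷ xs)    B∈          = there (free-down xs B∈)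
free-down ((C , just (suc i)) ∷ xs) (there B∈)  = there (free-down xs B∈)

inf₁-closed : (C : Formula) (t : Tree 1) → Closed t → Closed (inf C t [])
inf₁-closed C t closed B B∈ =
  closed B (Eq.subst ((B , nothing) ∈_) (++-identityʳ (occs t)) (free-down (occs t ++ []) B∈))

valid-closed : ∀ {𝔅 D J A} → Closed D → concl D ≡ just A → ValidC 𝔅 A D J → Valid 𝔅 D J
valid-closed closed concl≡A valid =
  (λ _ A′ concl≡A′ →
     Eq.subst (λ X → ValidC _ X _ _) (just-injective (trans (sym concl≡A) concl≡A′)) valid) ,
  (λ not-closed → ⊥-elim (not-closed closed))

∨-intro-valid : ∀ {𝔅 A B J} (c : ArgStr) → Closed c →
                (concl c ≡ just A × ValidC 𝔅 A c J) ⊎ (concl c ≡ just B × ValidC 𝔅 B c J) →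
                ValidC 𝔅 (A ∨' B) (inf (A ∨' B) (weaken c) []) J
∨-intro-valid {𝔅} {A} {B} {J} c closed premise =
  weaken c , ε , inf₁-closed (A ∨' B) (weaken c) (weaken-closed c closed) , weaken-noRootDis c ,
  Sum.map lift lift premise
  where
  lift : ∀ {C} → concl c ≡ just C × ValidC 𝔅 C c J →
         concl (weaken c) ≡ just C × ValidC 𝔅 C (restrict (weaken c)) J
  lift (concl≡C , valid) =
    trans (concl-weaken c) concl≡C ,
    Eq.subst (λ D → ValidC 𝔅 _ D J) (sym (restrict-weaken c)) valid

∨-intro-argument : ∀ {𝔅 A B} (c : ArgStr) (J : JSet) → Closed c →
                   (concl c ≡ just A × ValidC 𝔅 A c J) ⊎ (concl c ≡ just B × ValidC 𝔅 B c J) →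
                   Σ ArgStr λ D → Σ JSet λ J → Closed D × concl D ≡ just (A ∨' B) × Valid 𝔅 D J
∨-intro-argument {A = A} {B} c J closed premise =
  D , J , closed-D , refl , valid-closed closed-D refl (∨-intro-valid c closed premise)
  where
  D : ArgStr
  D = inf (A ∨' B) (weaken c) []
  closed-D : Closed D
  closed-D = inf₁-closed (A ∨' B) (weaken c) (weaken-closed c closed)

HasClosedValidArgument : Base → Formula → Set₁
HasClosedValidArgument 𝔅 A =
  Σ ArgStr λ c → Σ JSet λ J → Closed c × concl c ≡ just A × ValidC 𝔅 A c J

refutation : Formula → ArgStr
refutation A = inf (¬' A) (inf ⊥' (hyp A (just (suc zero))) []) []

refutation-closed : (A : Formula) → Closed (refutation A)
refutation-closed A B ()

refutation-valid : ∀ {𝔅 A J} → ¬ HasClosedValidArgument 𝔅 A → ValidC 𝔅 (¬' A) (refutation A) J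
refutation-valid {A = A} unprovable =
  inf ⊥' (hyp A (just (suc zero))) [] , ε , refutation-closed A , refl , only-A ,
  (λ closed → ⊥-elim (closed A (here refl))) ,
  (λ _ c J⁺ _ closed concl≡A valid → ⊥-elim (unprovable (c , J⁺ , closed , concl≡A , valid)))
  where
  only-A : RootDisOnly A (inf ⊥' (hyp A (just (suc zero))) [])
  only-A B (here refl) = refl

proposition3 : ExcludedMiddle (lsuc 0ℓ) → (𝔅 : Base) → Consistent 𝔅 → (A : Formula) →
    Σ ArgStr λ D → Σ JSet λ J →
      Closed D × concl D ≡ just (A ∨' ¬' A) × Valid 𝔅 D J
proposition3 em 𝔅 _ A with em {HasClosedValidArgument 𝔅 A}
... | yes (c , J , closed , concl≡A , valid) =
  ∨-intro-argument c J closed (inj₁ (concl≡A , valid))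
... | no unprovable =
  ∨-intro-argument (refutation A) (λ _ → ⊥) (refutation-closed A)
                   (inj₂ (refl , refutation-valid unprovable))
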